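{- Let $R$ be a finite set and let $\mathcal{S}_1,\ldots,\mathcal{S}_k$ be $k$ collections of subsets of $R$. Construct the vertex-colored graph $(G,\mathrm{col})$ as follows. For each $i\in[k]$ and each set $S\in\mathcal{S}_i$ create a vertex (these vertices form the set $I_i$) with color $i$; the vertices of $I_1\cup\cdots\cup I_k$ form an independent set. For each $i\in[k]$ create a set $L_i$ of $3k$ new vertices, each of color $k+1$, and join every vertex of $L_i$ to every vertex of $I_i$. For each vertex $v\in L_1\cup\cdots\cup L_k$ create $k$ new degree-one vertices adjacent to $v$, colored $1,\ldots,k$ respectively. For each element $e\in R$ create a vertex $e$ of color $k+1$, and for each $i\in[k]$ and each $S\in\mathcal{S}_i$ with $e\in S$, join $e$ to the vertex of $I_i$ representing $S$. Finally add a vertex $u$ of color $k+1$ adjacent to all vertices of $I_1\cup\cdots\cup I_k$. If $\mathrm{OPT}_{\mathrm{Free}}(G,\mathrm{col})\le 2k$, then there exist sets $S_1\in\mathcal{S}_1,\ldots,S_k\in\mathcal{S}_k$ with $\bigcup_{i\in[k]}S_i=R$.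
   Context: For a graph $G=(V,E)$ and a coloring $\mathrm{col}\colon V\to[c_{\max}]$, $\mathrm{Comp}(\mathrm{col},u)$ denotes the monochromatic connected component containing $u$ (the maximal set of vertices of color $\mathrm{col}(u)$ reachable from $u$ via paths all of whose vertices have color $\mathrm{col}(u)$). A move is a pair $(u,c)$ with $u\in V$ and $c$ a color; its result is the coloring obtained by recoloring every vertex of $\mathrm{Comp}(\mathrm{col},u)$ with $c$ and leaving other vertices unchanged. A sequence of moves is applied successively. $\mathrm{OPT}_{\mathrm{Free}}(G,\mathrm{col})$ is the minimum number of moves in a sequence whose result is a constant coloring (all vertices the same color). -}

module Defs where

open import Data.Nat using (ℕ; zero; suc; _*_)
open import Data.Fin using (Fin; inject₁; fromℕ)
open import Data.Fin.Subset using (Subset; _∈_)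
open import Data.Sum using (_⊎_)
open import Data.Product using (_×_)
open import Relation.Nullary using (¬_)
open import Relation.Binary.PropositionalEquality using (_≡_)

module FloodIt {V : Set} (Adj : V → V → Set) (C : Set) where

  Coloring : Set
  Coloring = V → C

  data MonoReach (col : Coloring) (c : C) : V → V → Set where
    here : ∀ {x} → col x ≡ c → MonoReach col c x x
    step : ∀ {x y z} → MonoReach col c x y → Adj y z → col z ≡ c →
           MonoReach col c x z

  InComp : Coloring → V → V → Set
  InComp col u v = MonoReach col (col u) u v

  MoveResult : Coloring → V → C → Coloring → Set
  MoveResult col u c col' =
    ∀ v → (InComp col u v → col' v ≡ c) × (¬ InComp col u v → col' v ≡ col v)

  Constant : Coloring → Set
  Constant col = Data.Product.Σ C (λ c → ∀ v → col v ≡ c)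
    where import Data.Product

  data Flooding : Coloring → ℕ → Set where
    done : ∀ {col} → Constant col → Flooding col zero
    move : ∀ {col n} (u : V) (c : C) (col' : Coloring) →
           MoveResult col u c col' → Flooding col' n → Flooding col (suc n)

  OPTFree≤ : Coloring → ℕ → Set
  OPTFree≤ col b = Data.Product.Σ ℕ (λ n → (n Data.Nat.≤ b) × Flooding col n)
    where import Data.Product
          import Data.Nat

-- R = Fin r; colours 1..k+1 are Fin (suc k), with
-- colour i ∈ [k] ↦ inject₁ i and colour k+1 ↦ fromℕ k.
-- Collection 𝒮_i is given as an indexed family S i : Fin (m i) → Subset r.

module Construction (k r : ℕ) (m : Fin k → ℕ)
                    (S : (i : Fin k) → Fin (m i) → Subset r) where

  data Vertex : Set where
    I : (i : Fin k) → Fin (m i) → Vertex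
    L : (i : Fin k) → Fin (3 * k) → Vertex
    P : (i : Fin k) → Fin (3 * k) → Fin k → Vertex     -- pendant of L i j, colour c
    E : Fin r → Vertex
    U : Vertex

  data Edge : Vertex → Vertex → Set where
    L-I : ∀ i j s → Edge (L i j) (I i s)
    P-L : ∀ i j c → Edge (P i j c) (L i j)
    E-I : ∀ e i s → e ∈ S i s → Edge (E e) (I i s)
    U-I : ∀ i s → Edge U (I i s)

  Adj : Vertex → Vertex → Set
  Adj x y = Edge x y ⊎ Edge y x

  Colour : Set
  Colour = Fin (suc k)

  col : Vertex → Colour
  col (I i _)   = inject₁ i
  col (L _ _)   = fromℕ k
  col (P _ _ c) = inject₁ c
  col (E _)     = fromℕ k
  col U         = fromℕ k

  open FloodIt Adj Colour public

-- Write K for the colour k+1 carried initially by the hub vertices L, E, U.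
-- (1) Stars.  A vertex L i j with its k pendants forms a star that touches the
--     rest of the graph only through I i.  A move is faithful to a star if it
--     recolours the star only together with some vertex of I i; one move is
--     unfaithful to at most one star per class, so as at most 2k < 3k moves
--     are made, every class has a star to which the whole run is faithful.
-- (2) Potential.  The number of pendants of such a star whose colour differs
--     from the centre is k while the star is intact, 0 at the end, and drops
--     by at most one per move; one extra move is needed if the centre is cut
--     off from an element vertex of colour K.
-- (3) Phases.  While no hub vertex has been recoloured, a move of colour ≠ K
--     recolours a single vertex.  Following every class through the phases
--     untouched → waiting → decided (exactly one vertex of I i has colour K),
--     flooding needs one move per untouched class, k moves for a star and one
--     more, unless the decided sets cover R.  With all k classes untouched at
--     the start, this is 2k + 1 moves.
module Submission where

open import Defs
open import Data.Nat using (ℕ; _≤_; _*_)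
open import Data.Fin using (Fin)
open import Data.Fin.Subset using (Subset; _∈_)
open import Data.Product using (Σ; ∃)

open import Data.Bool using (true; false)
open import Data.Empty using (⊥; ⊥-elim)
open import Data.Fin using (zero; suc; _≟_; fromℕ; fromℕ<; inject₁)
open import Data.Fin.Properties using (any?; all?; ¬∀⟶∃¬; fromℕ≢inject₁; inject₁-injective)
open import Data.Fin.Subset using (_∉_; _∪_; ⁅_⁆; _-_; ∣_∣; ⊤; Nonempty; Empty)
open import Data.Fin.Subset.Properties
  using (_∈?_; nonempty?; p⊆q⇒∣p∣≤∣q∣; ∪-identityʳ; x∈p∪q⁺; x∈⁅x⁆; p─q⊆p; x∈p∧x≢y⇒x∈p-y; ∣⊤∣≡n;
         Empty-unique; ∣⊥∣≡0)
open import Data.Nat using (zero; suc; _+_; _<_; s≤s)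
open import Data.Nat.Properties
  using (≤-refl; ≤-trans; ≤-reflexive; ≤-pred; n≤1+n; +-monoˡ-≤; +-identityʳ; m<n+m; n≮n)
open import Data.Product using (_×_; _,_; proj₁; proj₂)
open import Data.Sum using (_⊎_; inj₁; inj₂; swap; [_,_]′; map₂)
import Data.Unit as Unit
open import Data.Vec using (tabulate; _∷_; there)
open import Data.Vec.Properties using (lookup∘tabulate; []=⇒lookup; lookup⇒[]=)
open import Data.Vec.Functional using (updateAt)
open import Data.Vec.Functional.Properties using (updateAt-updates; updateAt-minimal)
open import Function using (id; _∘_; _∘′_; const)
open import Relation.Nullary using (¬_; Dec; yes; no; does; contradiction)
open import Relation.Nullary.Decidable using (_×-dec_; _⊎-dec_; ¬?; decidable-stable; dec-true)
open import Relation.Unary using (Pred; Decidable)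
open import Relation.Binary.Definitions using (DecidableEquality)
open import Relation.Binary.PropositionalEquality

private variable n : ℕ

select : ∀ {ℓ} {P : Pred (Fin n) ℓ} → Decidable P → Subset n
select P? = tabulate (λ x → does (P? x))

module _ {ℓ} {P : Pred (Fin n) ℓ} (P? : Decidable P) where

  ∈-select⁺ : ∀ {x} → P x → x ∈ select P?
  ∈-select⁺ {x} px = lookup⇒[]= x (select P?) (trans (lookup∘tabulate _ x) (dec-true (P? x) px))

  ∈-select⁻ : ∀ {x} → x ∈ select P? → P x
  ∈-select⁻ {x} x∈ = witness (P? x) (trans (sym (lookup∘tabulate _ x)) ([]=⇒lookup x∈))
    where
    witness : (d : Dec (P x)) → does d ≡ true → P x
    witness (yes px) _ = px

x∉p-x : ∀ (p : Subset n) x → x ∉ p - x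
x∉p-x (true ∷ p) zero ()
x∉p-x (false ∷ p) zero ()
x∉p-x (b ∷ p) (suc x) (there x∈) = x∉p-x p x x∈

∣p∪⁅x⁆∣≤1+∣p∣ : ∀ (p : Subset n) x → ∣ p ∪ ⁅ x ⁆ ∣ ≤ suc ∣ p ∣
∣p∪⁅x⁆∣≤1+∣p∣ (true ∷ p)  zero    rewrite ∪-identityʳ p = n≤1+n (suc ∣ p ∣)
∣p∪⁅x⁆∣≤1+∣p∣ (false ∷ p) zero    rewrite ∪-identityʳ p = ≤-refl
∣p∪⁅x⁆∣≤1+∣p∣ (true ∷ p)  (suc x) = s≤s (∣p∪⁅x⁆∣≤1+∣p∣ p x)
∣p∪⁅x⁆∣≤1+∣p∣ (false ∷ p) (suc x) = ∣p∪⁅x⁆∣≤1+∣p∣ p x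

⊆-but-one⇒∣p∣≤1+∣q∣ : ∀ {p q : Subset n} a → (∀ {x} → x ∈ p → x ≢ a → x ∈ q) →
                      ∣ p ∣ ≤ suc ∣ q ∣
⊆-but-one⇒∣p∣≤1+∣q∣ {q = q} a p⊆q∪a =
  ≤-trans (p⊆q⇒∣p∣≤∣q∣ p⊆q∪⁅a⁆) (∣p∪⁅x⁆∣≤1+∣p∣ q a)
  where
  p⊆q∪⁅a⁆ : ∀ {x} → x ∈ _ → x ∈ q ∪ ⁅ a ⁆
  p⊆q∪⁅a⁆ {x} x∈p with x ≟ a
  ... | yes refl = x∈p∪q⁺ (inj₂ (x∈⁅x⁆ x))
  ... | no  x≢a  = x∈p∪q⁺ (inj₁ (p⊆q∪a x∈p x≢a))

∈-remove⁻ : ∀ {p : Subset n} {x y} → x ∈ p - y → x ∈ p × x ≢ y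
∈-remove⁻ {p = p} {y = y} x∈ = p─q⊆p p ⁅ y ⁆ x∈ , λ { refl → x∉p-x p y x∈ }

∣p∣≤1+∣p-x∣ : ∀ (p : Subset n) x → ∣ p ∣ ≤ suc ∣ p - x ∣
∣p∣≤1+∣p-x∣ p x = ⊆-but-one⇒∣p∣≤1+∣q∣ {p = p} {q = p - x} x x∈p∧x≢y⇒x∈p-y

Empty⇒∣p∣≡0 : ∀ {p : Subset n} → Empty p → ∣ p ∣ ≡ 0
Empty⇒∣p∣≡0 {n} e rewrite Empty-unique e = ∣⊥∣≡0 n

n≤∣select∣ : ∀ {ℓ} {P : Pred (Fin n) ℓ} (P? : Decidable P) → (∀ x → P x) → n ≤ ∣ select P? ∣
n≤∣select∣ {n} P? all =
  subst (_≤ ∣ select P? ∣) (∣⊤∣≡n n)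
        (p⊆q⇒∣p∣≤∣q∣ {p = ⊤} (λ {x} _ → ∈-select⁺ P? (all x)))

∣p∣>0⇒Nonempty : ∀ {p : Subset n} → 0 < ∣ p ∣ → Nonempty p
∣p∣>0⇒Nonempty {p = p} pos with nonempty? p
... | yes ne = ne
... | no  e  = contradiction (subst (0 <_) (Empty⇒∣p∣≡0 e) pos) λ ()

fromℕ-or-inject₁ : ∀ (x : Fin (suc n)) → x ≡ fromℕ n ⊎ ∃ λ c → x ≡ inject₁ c
fromℕ-or-inject₁ {zero}  zero    = inj₁ refl
fromℕ-or-inject₁ {suc n} zero    = inj₂ (zero , refl)
fromℕ-or-inject₁ {suc n} (suc x) with fromℕ-or-inject₁ x
... | inj₁ x≡n       = inj₁ (cong suc x≡n)
... | inj₂ (c , x≡c) = inj₂ (suc c , cong suc x≡c)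

module MoveFacts {V : Set} (Adj : V → V → Set) (Adj-sym : ∀ {x y} → Adj x y → Adj y x)
                 {C : Set} (_≟ᶜ_ : DecidableEquality C) where

  open FloodIt Adj C

  reach-colour : ∀ {κ c x y} → MonoReach κ c x y → κ y ≡ c
  reach-colour (here e)     = e
  reach-colour (step _ _ e) = e

  reach-trans : ∀ {κ c x y z} → MonoReach κ c x y → MonoReach κ c y z → MonoReach κ c x z
  reach-trans p (here _)       = p
  reach-trans p (step q adj e) = step (reach-trans p q) adj e

  reach-sym : ∀ {κ c x y} → MonoReach κ c x y → MonoReach κ c y x
  reach-sym (here e)       = here e
  reach-sym (step p adj e) = reach-trans (step (here e) (Adj-sym adj) (reach-colour p)) (reach-sym p)

  Changes : Coloring → Coloring → V → Set
  Changes κ κ' x = ¬ κ' x ≡ κ x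

  module Move {κ : Coloring} {u : V} {c : C} {κ' : Coloring} (mv : MoveResult κ u c κ') where

    unchanged : ∀ {x} → ¬ Changes κ κ' x → κ' x ≡ κ x
    unchanged {x} = decidable-stable (κ' x ≟ᶜ κ x)

    changed⇒¬¬InComp : ∀ {x} → Changes κ κ' x → ¬ ¬ InComp κ u x
    changed⇒¬¬InComp {x} ch ∉comp = ch (proj₂ (mv x) ∉comp)

    changed-old : ∀ {x} → Changes κ κ' x → κ x ≡ κ u
    changed-old {x} ch = decidable-stable (κ x ≟ᶜ κ u)
      (λ ne → changed⇒¬¬InComp ch (λ ∈comp → ne (reach-colour ∈comp)))

    changed-new : ∀ {x} → Changes κ κ' x → κ' x ≡ c
    changed-new {x} ch = decidable-stable (κ' x ≟ᶜ c)
      (λ ne → changed⇒¬¬InComp ch (λ ∈comp → ne (proj₁ (mv x) ∈comp)))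

    changed-same-colour : ∀ {x y} → Changes κ κ' x → Changes κ κ' y → κ x ≡ κ y
    changed-same-colour chx chy = trans (changed-old chx) (sym (changed-old chy))

    changed-spreads : ∀ {x y} → Changes κ κ' x → InComp κ u y → Changes κ κ' y
    changed-spreads {x} {y} chx ∈comp eq = chx (begin
      κ' x ≡⟨ changed-new chx ⟩
      c    ≡⟨ sym (proj₁ (mv y) ∈comp) ⟩
      κ' y ≡⟨ eq ⟩
      κ y  ≡⟨ reach-colour ∈comp ⟩
      κ u  ≡⟨ sym (changed-old chx) ⟩
      κ x  ∎)
      where open ≡-Reasoning

module Reduction (k r : ℕ) (m : Fin k → ℕ) (S : (i : Fin k) → Fin (m i) → Subset r) where
  open Construction k r m S

  open MoveFacts Adj swap (_≟_ {suc k})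

  I-injectiveˡ : ∀ {i j s s'} → I i s ≡ I j s' → i ≡ j
  I-injectiveˡ refl = refl

  I-injectiveʳ : ∀ {i s s'} → I i s ≡ I i s' → s ≡ s'
  I-injectiveʳ refl = refl

  data InStar (i : Fin k) (j : Fin (3 * k)) : Vertex → Set where
    at-centre  : InStar i j (L i j)
    at-pendant : ∀ c → InStar i j (P i j c)

  inStar? : ∀ i j x → Dec (InStar i j x)
  inStar? i j (L i' j') with i' ≟ i | j' ≟ j
  ... | yes refl | yes refl = yes at-centre
  ... | no i'≢i  | _        = no λ { at-centre → i'≢i refl }
  ... | yes refl | no j'≢j  = no λ { at-centre → j'≢j refl }
  inStar? i j (P i' j' c) with i' ≟ i | j' ≟ j
  ... | yes refl | yes refl = yes (at-pendant c)
  ... | no i'≢i  | _        = no λ { (at-pendant _) → i'≢i refl }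
  ... | yes refl | no j'≢j  = no λ { (at-pendant _) → j'≢j refl }
  inStar? i j (I _ _) = no λ ()
  inStar? i j (E _)   = no λ ()
  inStar? i j U       = no λ ()

  inStar-unique : ∀ {i j j' x} → InStar i j x → InStar i j' x → j ≡ j'
  inStar-unique at-centre      at-centre       = refl
  inStar-unique (at-pendant c) (at-pendant .c) = refl

  -- The star (i , j) is attached to the rest of the graph only by the edges
  -- between its centre L i j and the vertices I i s.
  Exit : Coloring → Colour → Vertex → Fin k → Fin (3 * k) → Set
  Exit κ c a i j = MonoReach κ c a (L i j) × ∃ λ s → MonoReach κ c a (I i s)

  exit-edge : ∀ {κ c a y z i j} → InStar i j y → Adj y z → ¬ InStar i j z →
              MonoReach κ c a y → κ z ≡ c → Exit κ c a i j
  exit-edge at-centre      (inj₁ (L-I _ _ s))   _  p z≡c = p , s , step p (inj₁ (L-I _ _ s)) z≡c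
  exit-edge at-centre      (inj₂ (P-L _ _ c))   z∉ _ _   = contradiction (at-pendant c) z∉
  exit-edge (at-pendant c) (inj₁ (P-L _ _ .c))  z∉ _ _   = contradiction at-centre z∉
  exit-edge (at-pendant c) (inj₂ ())            _  _ _

  exit-path : ∀ {κ c a b i j} → MonoReach κ c a b → InStar i j a → ¬ InStar i j b → Exit κ c a i j
  exit-path (here _) a∈ b∉ = contradiction a∈ b∉
  exit-path {i = i} {j} (step {y = y} p adj z≡c) a∈ z∉ with inStar? i j y
  ... | yes y∈ = exit-edge y∈ adj z∉ p z≡c
  ... | no  y∉ = exit-path p a∈ y∉

  component-exits : ∀ {κ u x y i j} → InComp κ u x → InComp κ u y →
                    InStar i j x → ¬ InStar i j y → Exit κ (κ u) u i j
  component-exits u→x u→y x∈ y∉ with exit-path (reach-trans (reach-sym u→x) u→y) x∈ y∉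
  ... | x→L , s , x→I = reach-trans u→x x→L , s , reach-trans u→x x→I

  StarChanges : Coloring → Coloring → Fin k → Fin (3 * k) → Set
  StarChanges κ κ' i j = Changes κ κ' (L i j) ⊎ ∃ λ c → Changes κ κ' (P i j c)

  IChanges : Coloring → Coloring → Fin k → Set
  IChanges κ κ' i = ∃ λ s → Changes κ κ' (I i s)

  IChanges? : ∀ κ κ' i → Dec (IChanges κ κ' i)
  IChanges? κ κ' i = any? λ s → ¬? (κ' (I i s) ≟ κ (I i s))

  Faithful : Coloring → Coloring → Fin k → Fin (3 * k) → Set
  Faithful κ κ' i j = StarChanges κ κ' i j → IChanges κ κ' i

  Unfaithful : Coloring → Coloring → Fin k → Fin (3 * k) → Set
  Unfaithful κ κ' i j = StarChanges κ κ' i j × ¬ IChanges κ κ' i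

  Unfaithful? : ∀ κ κ' i j → Dec (Unfaithful κ κ' i j)
  Unfaithful? κ κ' i j =
    (¬? (κ' (L i j) ≟ κ (L i j)) ⊎-dec any? (λ c → ¬? (κ' (P i j c) ≟ κ (P i j c))))
    ×-dec ¬? (IChanges? κ κ' i)

  ¬unfaithful⇒faithful : ∀ {κ κ' i j} → ¬ Unfaithful κ κ' i j → Faithful κ κ' i j
  ¬unfaithful⇒faithful {κ} {κ'} {i} ¬unf star-changes =
    decidable-stable (IChanges? κ κ' i) (λ ¬I → ¬unf (star-changes , ¬I))

  star-witness : ∀ {κ κ' i j} → StarChanges κ κ' i j → ∃ λ x → InStar i j x × Changes κ κ' x
  star-witness (inj₁ ch)       = _ , at-centre , ch
  star-witness (inj₂ (c , ch)) = _ , at-pendant c , ch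

  -- A single move is unfaithful to at most one star of each class: the
  -- recoloured component would otherwise join two stars through I i.
  unfaithful-unique : ∀ {κ u c κ'} → MoveResult κ u c κ' → ∀ {i j j'} →
                      Unfaithful κ κ' i j → Unfaithful κ κ' i j' → j ≡ j'
  unfaithful-unique mv {i} {j} {j'} (sc , ¬I) (sc' , _) with j ≟ j'
  ... | yes j≡j' = j≡j'
  ... | no  j≢j' with star-witness sc | star-witness sc'
  ... | x , x∈ , chx | x' , x'∈ , chx' =
    ⊥-elim (changed⇒¬¬InComp chx λ u→x → changed⇒¬¬InComp chx' λ u→x' →
      let (_ , s , u→I) = component-exits u→x u→x' x∈ (λ x'∈j → j≢j' (inStar-unique x'∈j x'∈))
      in ¬I (s , changed-spreads chx u→I))
    where open Move mv

  FaithfulRun : ∀ {κ n} → Fin k → Fin (3 * k) → Flooding κ n → Set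
  FaithfulRun i j (done _)                     = Unit.⊤
  FaithfulRun i j (move {col = κ} _ _ κ' _ F) = Faithful κ κ' i j × FaithfulRun i j F

  -- Pigeonhole: a run of n moves is faithful to some star (i , j) with
  -- j ∈ A as soon as A contains more than n stars, since each move is
  -- unfaithful to at most one of them.
  faithful-star : ∀ {κ n} (F : Flooding κ n) i (A : Subset (3 * k)) → n < ∣ A ∣ →
                  ∃ λ j → j ∈ A × FaithfulRun i j F
  faithful-star (done _) i A n<∣A∣ with ∣p∣>0⇒Nonempty n<∣A∣
  ... | j , j∈A = j , j∈A , Unit.tt
  faithful-star (move {col = κ} u c κ' mv F) i A n<∣A∣
    with any? (λ j → (j ∈? A) ×-dec Unfaithful? κ κ' i j)
  ... | no none with faithful-star F i A (≤-trans (n≤1+n _) n<∣A∣)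
  ...   | j , j∈A , run =
    j , j∈A , ¬unfaithful⇒faithful {κ} {κ'} {i} {j} (λ unf → none (j , j∈A , unf)) , run
  faithful-star (move {col = κ} u c κ' mv F) i A n<∣A∣
      | yes (j₀ , j₀∈A , unf₀)
      with faithful-star F i (A - j₀) (≤-pred (≤-trans n<∣A∣ (∣p∣≤1+∣p-x∣ A j₀)))
  ...   | j , j∈A-j₀ , run with ∈-remove⁻ j∈A-j₀
  ...   | j∈A , j≢j₀ =
    j , j∈A , ¬unfaithful⇒faithful {κ} {κ'} {i} {j} (λ unf → j≢j₀ (unfaithful-unique mv unf unf₀)) , run

  K : Colour
  K = fromℕ k

  inject₁≢K : ∀ {c : Fin k} → ¬ inject₁ c ≡ K
  inject₁≢K eq = fromℕ≢inject₁ (sym eq)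

  -- The potential of the star (i , j) is the
  -- number of pendants whose colour differs from that of the centre: it is k
  -- while the star is intact, 0 in a constant colouring, and a move faithful
  -- to the star lowers it by at most one.
  module Star (i : Fin k) (j : Fin (3 * k)) where

    centre : Vertex
    centre = L i j

    pendant : Fin k → Vertex
    pendant = P i j

    record Intact (κ : Coloring) : Set where
      constructor intact-star
      field
        centre-K          : κ centre ≡ K
        pendants-original : ∀ c → κ (pendant c) ≡ inject₁ c

    Tidy : Coloring → Set
    Tidy κ = ∀ c → κ (pendant c) ≡ κ centre ⊎ κ (pendant c) ≡ inject₁ c

    Mismatched : Coloring → Fin k → Set
    Mismatched κ c = ¬ κ (pendant c) ≡ κ centre

    mismatched? : ∀ κ → Decidable (Mismatched κ)
    mismatched? κ c = ¬? (κ (pendant c) ≟ κ centre)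

    mismatch : Coloring → Subset k
    mismatch κ = select (mismatched? κ)

    intact⇒tidy : ∀ {κ} → Intact κ → Tidy κ
    intact⇒tidy (intact-star _ pend) c = inj₂ (pend c)

    intact⇒mismatched : ∀ {κ} → Intact κ → ∀ c → Mismatched κ c
    intact⇒mismatched (intact-star cen pend) c eq = inject₁≢K (trans (sym (pend c)) (trans eq cen))

    intact⇒k≤∣mismatch∣ : ∀ {κ} → Intact κ → k ≤ ∣ mismatch κ ∣
    intact⇒k≤∣mismatch∣ {κ} intact = n≤∣select∣ (mismatched? κ) (intact⇒mismatched {κ} intact)

    constant⇒no-mismatch : ∀ {κ} → Constant κ → ∀ {c} → c ∉ mismatch κ
    constant⇒no-mismatch {κ} (_ , const) c∈ = ∈-select⁻ (mismatched? κ) c∈ (trans (const _) (sym (const _)))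

    intact⇒¬constant : ∀ {κ} → Intact κ → ¬ Constant κ
    intact⇒¬constant {κ} intact const =
      constant⇒no-mismatch const (∈-select⁺ (mismatched? κ) (intact⇒mismatched intact i))

    mismatched-original : ∀ {κ} → Tidy κ → ∀ {c} → c ∈ mismatch κ → κ (pendant c) ≡ inject₁ c
    mismatched-original {κ} tidy {c} c∈ with tidy c
    ... | inj₁ same = contradiction same (∈-select⁻ (mismatched? κ) c∈)
    ... | inj₂ orig = orig

    -- Detached κ e: E e cannot join the star's centre without the centre
    -- being recoloured.
    Detached : Coloring → Fin r → Set
    Detached κ e = ¬ κ centre ≡ K ⊎ (Nonempty (mismatch κ) × ¬ InComp κ centre (E e))

    module FaithfulMove {κ u c κ'} (mv : MoveResult κ u c κ') (faithful : Faithful κ κ' i j) where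
      open Move mv

      -- A recoloured pendant drags the centre along (through some I i s).
      pendant⇒centre-changes : ∀ d → Changes κ κ' (pendant d) → Changes κ κ' centre
      pendant⇒centre-changes d chp with faithful (inj₂ (d , chp))
      ... | s , chI = λ eq → changed⇒¬¬InComp chp λ u→p → changed⇒¬¬InComp chI λ u→I →
            changed-spreads chp (proj₁ (component-exits u→p u→I (at-pendant d) λ ())) eq

      matched-kept : ∀ d → κ (pendant d) ≡ κ centre → κ' (pendant d) ≡ κ' centre
      matched-kept d same with κ' centre ≟ κ centre
      ... | yes cen-fixed =
        trans (unchanged (λ chp → pendant⇒centre-changes d chp cen-fixed)) (trans same (sym cen-fixed))
      ... | no  cen-ch = decidable-stable (κ' (pendant d) ≟ κ' centre) λ ne →
        changed⇒¬¬InComp cen-ch λ u→cen →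
        ne (trans (proj₁ (mv (pendant d)) (step u→cen (inj₂ (P-L i j d)) (trans same (reach-colour u→cen))))
                  (sym (changed-new cen-ch)))

      tidy-kept : Tidy κ → Tidy κ'
      tidy-kept tidy d with tidy d | κ' (pendant d) ≟ κ (pendant d)
      ... | inj₁ same | _          = inj₁ (matched-kept d same)
      ... | inj₂ orig | yes fixed  = inj₂ (trans fixed orig)
      ... | inj₂ _    | no  chp    =
        inj₁ (matched-kept d (changed-same-colour chp (pendant⇒centre-changes d chp)))

      mismatch-kept : Tidy κ → ∀ {d} → d ∈ mismatch κ → ¬ inject₁ d ≡ κ' centre → d ∈ mismatch κ'
      mismatch-kept tidy {d} d∈ d≢cen' = ∈-select⁺ (mismatched? κ') λ eq → d≢cen' (trans (sym pend') eq)
        where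
        pend' : κ' (pendant d) ≡ inject₁ d
        pend' = trans (unchanged λ chp → ∈-select⁻ (mismatched? κ) d∈
                                          (changed-same-colour chp (pendant⇒centre-changes d chp)))
                      (mismatched-original {κ} tidy d∈)

      ∣mismatch∣-step : Tidy κ → ∣ mismatch κ ∣ ≤ suc ∣ mismatch κ' ∣
      ∣mismatch∣-step tidy with fromℕ-or-inject₁ (κ' centre)
      ... | inj₁ cen≡K =
        ≤-trans (p⊆q⇒∣p∣≤∣q∣ λ d∈ → mismatch-kept tidy d∈ λ eq → inject₁≢K (trans eq cen≡K)) (n≤1+n _)
      ... | inj₂ (d₀ , cen≡d₀) = ⊆-but-one⇒∣p∣≤1+∣q∣ d₀ λ d∈ d≢d₀ →
        mismatch-kept tidy d∈ λ eq → d≢d₀ (inject₁-injective (trans eq cen≡d₀))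

      ∣mismatch∣-mono : Tidy κ → κ' centre ≡ K ⊎ κ' centre ≡ κ centre →
                        ∣ mismatch κ ∣ ≤ ∣ mismatch κ' ∣
      ∣mismatch∣-mono tidy cen' = p⊆q⇒∣p∣≤∣q∣ λ d∈ → mismatch-kept tidy d∈ (not-centre cen' d∈)
        where
        not-centre : κ' centre ≡ K ⊎ κ' centre ≡ κ centre →
                     ∀ {d} → d ∈ mismatch κ → ¬ inject₁ d ≡ κ' centre
        not-centre (inj₁ cen≡K)  _  eq = inject₁≢K (trans eq cen≡K)
        not-centre (inj₂ fixed) d∈ eq =
          ∈-select⁻ (mismatched? κ) d∈ (trans (mismatched-original {κ} tidy d∈) (trans eq fixed))

      detached-step : ∀ {e} → Tidy κ → κ (E e) ≡ K → Detached κ e →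
                      ∣ mismatch κ ∣ ≤ ∣ mismatch κ' ∣ ⊎
                      (∣ mismatch κ ∣ ≤ suc ∣ mismatch κ' ∣ × κ' (E e) ≡ K × Detached κ' e)
      detached-step {e} tidy e≡K detached with κ' centre ≟ κ centre | fromℕ-or-inject₁ (κ' centre)
      ... | yes fixed | _              = inj₁ (∣mismatch∣-mono tidy (inj₂ fixed))
      ... | no  _     | inj₁ cen≡K     = inj₁ (∣mismatch∣-mono tidy (inj₁ cen≡K))
      ... | no  cen-ch | inj₂ (d₀ , cen≡d₀) =
        inj₂ ( ∣mismatch∣-step tidy , trans (unchanged E-fixed) e≡K
             , inj₁ λ eq → inject₁≢K (trans (sym cen≡d₀) eq))
        where
        apart : InComp κ u (E e) → InComp κ u centre → Detached κ e → ⊥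
        apart u→E u→cen (inj₁ cen≢K) =
          cen≢K (trans (reach-colour u→cen) (trans (sym (reach-colour u→E)) e≡K))
        apart u→E u→cen (inj₂ (_ , ¬cen→E)) =
          ¬cen→E (subst (λ c → MonoReach κ c centre (E e)) (sym (reach-colour u→cen))
                        (reach-trans (reach-sym u→cen) u→E))
        E-fixed : ¬ Changes κ κ' (E e)
        E-fixed chE =
          changed⇒¬¬InComp chE λ u→E → changed⇒¬¬InComp cen-ch λ u→cen → apart u→E u→cen detached

      intact-kept-off-hub : Intact κ → ¬ κ u ≡ K → Intact κ'
      intact-kept-off-hub (intact-star cen pend) u≢K = intact-star
        (trans (unchanged cen-fixed) cen)
        λ d → trans (unchanged (λ chp → cen-fixed (pendant⇒centre-changes d chp))) (pend d)
        where
        cen-fixed : ¬ Changes κ κ' centre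
        cen-fixed ch = u≢K (trans (sym (changed-old ch)) cen)

      intact-kept-I-fixed : Intact κ → ¬ IChanges κ κ' i → Intact κ'
      intact-kept-I-fixed (intact-star cen pend) I-fixed = intact-star
        (trans (unchanged (λ ch → I-fixed (faithful (inj₁ ch)))) cen)
        λ d → trans (unchanged (λ ch → I-fixed (faithful (inj₂ (d , ch))))) (pend d)

    mismatch-bound : ∀ {κ n} (F : Flooding κ n) → FaithfulRun i j F → Tidy κ → ∣ mismatch κ ∣ ≤ n
    mismatch-bound (done const) _ _ =
      ≤-reflexive (Empty⇒∣p∣≡0 λ (_ , c∈) → constant⇒no-mismatch const c∈)
    mismatch-bound (move _ _ _ mv F) (faithful , run) tidy =
      ≤-trans (∣mismatch∣-step tidy) (s≤s (mismatch-bound F run (tidy-kept tidy)))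
      where open FaithfulMove mv faithful

    detached-bound : ∀ {κ n} e (F : Flooding κ n) → FaithfulRun i j F → Tidy κ →
                     κ (E e) ≡ K → Detached κ e → suc ∣ mismatch κ ∣ ≤ n
    detached-bound e (done (_ , const)) _ _ e≡K (inj₁ cen≢K) =
      ⊥-elim (cen≢K (trans (const centre) (trans (sym (const (E e))) e≡K)))
    detached-bound e (done const) _ _ _ (inj₂ ((_ , c∈) , _)) = ⊥-elim (constant⇒no-mismatch const c∈)
    detached-bound e (move _ _ _ mv F) (faithful , run) tidy e≡K detached =
      [ (λ mono → s≤s (≤-trans mono (mismatch-bound F run (tidy-kept tidy))))
      , (λ (drop , e≡K' , detached') →
           s≤s (≤-trans drop (detached-bound e F run (tidy-kept tidy) e≡K' detached')))
      ]′ (detached-step tidy e≡K detached)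
      where open FaithfulMove mv faithful

  record Hub (κ : Coloring) : Set where
    field
      L-hub : ∀ i j → κ (L i j) ≡ K
      E-hub : ∀ e → κ (E e) ≡ K
      U-hub : κ U ≡ K

  edge-meets-hub : ∀ {κ x y} → Hub κ → Edge x y → κ x ≡ K ⊎ κ y ≡ K
  edge-meets-hub H (L-I i j _)   = inj₁ (Hub.L-hub H i j)
  edge-meets-hub H (P-L i j _)   = inj₂ (Hub.L-hub H i j)
  edge-meets-hub H (E-I e _ _ _) = inj₁ (Hub.E-hub H e)
  edge-meets-hub H (U-I _ _)     = inj₁ (Hub.U-hub H)

  -- Every edge has an endpoint of colour k+1, so while Hub holds every
  -- monochromatic edge has colour k+1 ...
  mono-edge-is-hub : ∀ {κ y z c} → Hub κ → Adj y z → κ y ≡ c → κ z ≡ c → c ≡ K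
  mono-edge-is-hub H adj y≡c z≡c with [ edge-meets-hub H , swap ∘′ edge-meets-hub H ]′ adj
  ... | inj₁ y≡K = trans (sym y≡c) y≡K
  ... | inj₂ z≡K = trans (sym z≡c) z≡K

  off-hub-trivial : ∀ {κ c a b} → Hub κ → ¬ c ≡ K → MonoReach κ c a b → a ≡ b
  off-hub-trivial H c≢K (here _)          = refl
  off-hub-trivial H c≢K (step p adj z≡c) = ⊥-elim (c≢K (mono-edge-is-hub H adj (reach-colour p) z≡c))

  module OffHubMove {κ u c κ'} (mv : MoveResult κ u c κ') (H : Hub κ) (u≢K : ¬ κ u ≡ K) where
    open Move mv

    only-change : ∀ {x y} → Changes κ κ' y → ¬ x ≡ y → κ' x ≡ κ x
    only-change chy x≢y = unchanged λ chx →
      changed⇒¬¬InComp chx λ u→x → changed⇒¬¬InComp chy λ u→y →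
      x≢y (trans (sym (off-hub-trivial H u≢K u→x)) (off-hub-trivial H u≢K u→y))

    hub-kept : Hub κ'
    hub-kept = record
      { L-hub = λ i j → K-kept (Hub.L-hub H i j)
      ; E-hub = λ e → K-kept (Hub.E-hub H e)
      ; U-hub = K-kept (Hub.U-hub H)
      }
      where
      K-kept : ∀ {x} → κ x ≡ K → κ' x ≡ K
      K-kept x≡K = trans (unchanged λ ch → u≢K (trans (sym (changed-old ch)) x≡K)) x≡K

  record Decided (κ : Coloring) (i : Fin k) : Set where
    constructor decided-at
    field
      choice      : Fin (m i)
      choice-K    : κ (I i choice) ≡ K
      only-choice : ∀ s → κ (I i s) ≡ K → s ≡ choice

  Cover : Set
  Cover = Σ ((i : Fin k) → Fin (m i)) (λ σ → (e : Fin r) → ∃ (λ i → e ∈ S i (σ i)))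

  entering-element : ∀ {κ c a e} → MonoReach κ c a (E e) → ¬ a ≡ E e →
                     ∃ λ i → ∃ λ s → e ∈ S i s × κ (I i s) ≡ c
  entering-element (here _) a≢E                             = ⊥-elim (a≢E refl)
  entering-element (step p (inj₁ ()) _) _
  entering-element (step p (inj₂ (E-I _ i s e∈S)) _) _ = i , s , e∈S , reach-colour p

  chosen : ∀ {κ} → (∀ i → Decided κ i) → (i : Fin k) → Fin (m i)
  chosen decided i = Decided.choice (decided i)

  -- The only vertex of I i of colour k+1 is the chosen one.
  chosen-covers : ∀ {κ e} (decided : ∀ i → Decided κ i) →
                  (∃ λ i → ∃ λ s → e ∈ S i s × κ (I i s) ≡ K) →
                  ∃ λ i → e ∈ S i (chosen decided i)
  chosen-covers {e = e} decided (i , s , e∈S , I≡K) =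
    i , subst (λ t → e ∈ S i t) (Decided.only-choice (decided i) s I≡K) e∈S

  cover-or-isolated : ∀ {κ} → (∀ i → Decided κ i) →
                      Cover ⊎ ∃ λ e → ∀ {a} → ¬ a ≡ E e → ¬ MonoReach κ K a (E e)
  cover-or-isolated decided with all? (λ e → any? λ i → e ∈? S i (chosen decided i))
  ... | yes covered = inj₁ (chosen decided , covered)
  ... | no ¬covered with ¬∀⟶∃¬ r _ (λ e → any? λ i → e ∈? S i (chosen decided i)) ¬covered
  ...   | e , uncovered =
    inj₂ (e , λ a≢E a→E → uncovered (chosen-covers decided (entering-element a→E a≢E)))

  data Phase : Set where
    untouched waiting decided : Phase

  untouched? : ∀ p → Dec (p ≡ untouched)
  untouched? untouched = yes refl
  untouched? waiting   = no λ ()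
  untouched? decided   = no λ ()

  decided? : ∀ p → Dec (p ≡ decided)
  decided? untouched = no λ ()
  decided? waiting   = no λ ()
  decided? decided   = yes refl

  Active : Phase → Set
  Active p = ¬ p ≡ decided

  untouched-active : ∀ {p} → p ≡ untouched → Active p
  untouched-active refl ()

  _[_↦_] : (Fin k → Phase) → Fin k → Phase → (Fin k → Phase)
  ph [ j ↦ p ] = updateAt ph j (const p)

  untouchedSet : (Fin k → Phase) → Subset k
  untouchedSet ph = select (untouched? ∘ ph)

  none-active⇒no-untouched : ∀ {ph} → ¬ (∃ λ i → Active (ph i)) → ∣ untouchedSet ph ∣ ≡ 0
  none-active⇒no-untouched {ph} none =
    Empty⇒∣p∣≡0 λ (i , i∈) → none (i , untouched-active (∈-select⁻ (untouched? ∘ ph) i∈))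

  ∣untouched∣-update : ∀ ph j p → ∣ untouchedSet ph ∣ ≤ suc ∣ untouchedSet (ph [ j ↦ p ]) ∣
  ∣untouched∣-update ph j p = ⊆-but-one⇒∣p∣≤1+∣q∣ j λ {i} i∈ i≢j →
    ∈-select⁺ (untouched? ∘ (ph [ j ↦ p ]))
              (trans (updateAt-minimal i j ph i≢j) (∈-select⁻ (untouched? ∘ ph) i∈))

  module Bounds (star : Fin k → Fin (3 * k)) where

    module St (i : Fin k) = Star i (star i)

    Intact : Coloring → Fin k → Set
    Intact κ i = St.Intact i κ

    AllFaithful : ∀ {κ n} → Flooding κ n → Set
    AllFaithful F = ∀ i → FaithfulRun i (star i) F

    Untouched : Coloring → Fin k → Set
    Untouched κ i = (∀ s → κ (I i s) ≡ inject₁ i) × Intact κ i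

    Waiting : Coloring → Fin k → Set
    Waiting κ i = (∀ s → ¬ κ (I i s) ≡ K) × Intact κ i

    PhaseInv : Coloring → Fin k → Phase → Set
    PhaseInv κ i untouched = Untouched κ i
    PhaseInv κ i waiting   = Waiting κ i
    PhaseInv κ i decided   = Decided κ i

    active⇒waiting : ∀ {κ i p} → Active p → PhaseInv κ i p → Waiting κ i
    active⇒waiting {p = untouched} _ (orig , intact) = (λ s eq → inject₁≢K (trans (sym (orig s)) eq)) , intact
    active⇒waiting {p = waiting}   _ inv             = inv
    active⇒waiting {p = decided}   act _             = contradiction refl act

    phase-kept : ∀ {κ u c κ' i} p → MoveResult κ u c κ' → Faithful κ κ' i (star i) →
                 ¬ IChanges κ κ' i → PhaseInv κ i p → PhaseInv κ' i p
    phase-kept {κ} {κ' = κ'} {i} p mv faithful ¬I inv = kept p inv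
      where
      open Move mv
      open St.FaithfulMove i mv faithful
      I-fixed : ∀ s → κ' (I i s) ≡ κ (I i s)
      I-fixed s = unchanged λ ch → ¬I (s , ch)
      kept : ∀ p → PhaseInv κ i p → PhaseInv κ' i p
      kept untouched (orig , intact) = (λ s → trans (I-fixed s) (orig s)) , intact-kept-I-fixed intact ¬I
      kept waiting (¬K , intact) = (λ s eq → ¬K s (trans (sym (I-fixed s)) eq)) , intact-kept-I-fixed intact ¬I
      kept decided (decided-at s s-K only-s) =
        decided-at s (trans (I-fixed s) s-K) λ s' eq → only-s s' (trans (sym (I-fixed s')) eq)

    all-decided : ∀ {κ} {ph : Fin k → Phase} → (∀ i → PhaseInv κ i (ph i)) →
                  ¬ (∃ λ i → Active (ph i)) → ∀ i → Decided κ i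
    all-decided {κ} {ph} inv none i =
      subst (PhaseInv κ i) (decidable-stable (decided? (ph i)) λ act → none (i , act)) (inv i)

    update-inv : ∀ {κ ph j p} → PhaseInv κ j p → (∀ i → ¬ i ≡ j → PhaseInv κ i (ph i)) →
                 ∀ i → PhaseInv κ i ((ph [ j ↦ p ]) i)
    update-inv {κ} {ph} {j} inv-j inv-others i with i ≟ j
    ... | yes refl = subst (PhaseInv κ i) (sym (updateAt-updates i ph)) inv-j
    ... | no  i≢j  = subst (PhaseInv κ i) (sym (updateAt-minimal i j ph i≢j)) (inv-others i i≢j)

    -- While the classes in f are untouched and some star is intact, flooding
    -- needs one move per class of f (to recolour a vertex of I i) plus the k
    -- moves of the star potential.
    untouched-bound : ∀ {κ n} (F : Flooding κ n) → AllFaithful F → (f : Subset k) →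
                      (∀ {i} → i ∈ f → Untouched κ i) → ∀ {i₀} → Intact κ i₀ → ∣ f ∣ + k ≤ n
    untouched-bound (done const) _ _ _ {i₀} intact = ⊥-elim (St.intact⇒¬constant i₀ intact const)
    untouched-bound F@(move {col = κ} u c κ' mv F') faithful f untouched-f {i₀} intact with nonempty? f
    ... | no empty rewrite Empty⇒∣p∣≡0 empty =
      ≤-trans (St.intact⇒k≤∣mismatch∣ i₀ intact)
              (St.mismatch-bound i₀ F (faithful i₀) (St.intact⇒tidy i₀ intact))
    ... | yes (i₁ , i₁∈f) with any? (λ j → (j ∈? f) ×-dec IChanges? κ κ' j)
    ...   | no none =
      ≤-trans (untouched-bound F' (proj₂ ∘ faithful) f untouched-f' (proj₂ (untouched-f' i₁∈f))) (n≤1+n _)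
      where
      untouched-f' : ∀ {i} → i ∈ f → Untouched κ' i
      untouched-f' {i} i∈f =
        phase-kept untouched mv (proj₁ (faithful i)) (λ I → none (i , i∈f , I)) (untouched-f i∈f)
    ...   | yes (j , j∈f , s , chI) =
      ≤-trans (+-monoˡ-≤ k (∣p∣≤1+∣p-x∣ f j))
              (s≤s (untouched-bound F' (proj₂ ∘ faithful) (f - j) untouched-f' intact-j))
      where
      open Move mv
      u≡j : κ u ≡ inject₁ j
      u≡j = trans (sym (changed-old chI)) (proj₁ (untouched-f j∈f) s)
      intact-j : Intact κ' j
      intact-j = St.FaithfulMove.intact-kept-off-hub j mv (proj₁ (faithful j)) (proj₂ (untouched-f j∈f))
                   λ eq → inject₁≢K (trans (sym u≡j) eq)
      untouched-f' : ∀ {i} → i ∈ f - j → Untouched κ' i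
      untouched-f' {i} i∈ with ∈-remove⁻ i∈
      ... | i∈f , i≢j = phase-kept untouched mv (proj₁ (faithful i)) ¬I (untouched-f i∈f)
        where
        ¬I : ¬ IChanges κ κ' i
        ¬I (s' , ch) =
          i≢j (inject₁-injective (trans (sym (proj₁ (untouched-f i∈f) s')) (trans (changed-old ch) u≡j)))

    -- Once every class is decided, an intact star needs k + 1 more moves
    -- unless the decided sets cover R: the star is cut off from some element
    -- vertex.
    decided-finish : ∀ {κ n j} (F : Flooding κ n) → FaithfulRun j (star j) F → Hub κ →
                     (∀ i → Decided κ i) → Intact κ j → Cover ⊎ suc k ≤ n
    decided-finish {κ} {j = j} F run H decisions intact with cover-or-isolated decisions
    ... | inj₁ cover          = inj₁ cover
    ... | inj₂ (e , isolated) =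
      inj₂ (≤-trans (s≤s (St.intact⇒k≤∣mismatch∣ j intact))
                    (St.detached-bound j e F run (St.intact⇒tidy j intact) (Hub.E-hub H e) detached))
      where
      detached : St.Detached j κ e
      detached = inj₂ ( (j , ∈-select⁺ (St.mismatched? j κ) (St.intact⇒mismatched j intact j))
                      , λ path → isolated (λ ()) (subst (λ c → MonoReach κ c (St.centre j) (E e))
                                                        (St.Intact.centre-K intact) path))

    record AfterActiveMove (κ' : Coloring) (ph : Fin k → Phase) (j : Fin k) : Set where
      constructor after-move
      field
        hub-kept  : Hub κ'
        star-j    : Intact κ' j
        new-phase : Phase
        inv-j     : PhaseInv κ' j new-phase
        inv-rest  : ∀ i → ¬ i ≡ j → PhaseInv κ' i (ph i)

    active-move : ∀ {κ u c κ' ph j s} → MoveResult κ u c κ' → (∀ i → Faithful κ κ' i (star i)) →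
                  Hub κ → (∀ i → PhaseInv κ i (ph i)) → Active (ph j) → Changes κ κ' (I j s) →
                  AfterActiveMove κ' ph j
    active-move {κ} {u} {κ' = κ'} {ph} {j} {s} mv faithful H inv act-j chI =
      after-move hub-kept intact-j (proj₁ phase-j) (proj₂ phase-j) others
      where
      open Move mv
      waiting-j : Waiting κ j
      waiting-j = active⇒waiting act-j (inv j)
      u≢K : ¬ κ u ≡ K
      u≢K eq = proj₁ waiting-j s (trans (changed-old chI) eq)
      open OffHubMove mv H u≢K
      intact-j : Intact κ' j
      intact-j = St.FaithfulMove.intact-kept-off-hub j mv (faithful j) (proj₂ waiting-j) u≢K
      others : ∀ i → ¬ i ≡ j → PhaseInv κ' i (ph i)
      others i i≢j = phase-kept (ph i) mv (faithful i)
        (λ (s' , ch) → ch (only-change chI λ eq → i≢j (I-injectiveˡ eq))) (inv i)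
      elsewhere-not-K : ∀ {s'} → ¬ s' ≡ s → ¬ κ' (I j s') ≡ K
      elsewhere-not-K s'≢s eq =
        proj₁ waiting-j _ (trans (sym (only-change chI λ eq' → s'≢s (I-injectiveʳ eq'))) eq)
      by-new-colour : Dec (κ' (I j s) ≡ K) → ∃ (PhaseInv κ' j)
      by-new-colour (yes I≡K) = decided , decided-at s I≡K only-s
        where
        only-s : ∀ s' → κ' (I j s') ≡ K → s' ≡ s
        only-s s' eq with s' ≟ s
        ... | yes s'≡s = s'≡s
        ... | no  s'≢s = contradiction eq (elsewhere-not-K s'≢s)
      by-new-colour (no I≢K) = waiting , not-K , intact-j
        where
        not-K : ∀ s' → ¬ κ' (I j s') ≡ K
        not-K s' with s' ≟ s
        ... | yes refl = I≢K
        ... | no  s'≢s = elsewhere-not-K s'≢s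
      phase-j : ∃ (PhaseInv κ' j)
      phase-j = by-new-colour (κ' (I j s) ≟ K)

    one-more : ∀ {a b n} → a ≤ suc b → suc (b + k) ≤ n → suc (a + k) ≤ suc n
    one-more a≤1+b long = s≤s (≤-trans (+-monoˡ-≤ k a≤1+b) long)

    -- While Hub holds, every class is untouched, waiting
    -- or decided, and some class is not yet decided, either the decided sets
    -- cover R or flooding needs one move per untouched class, the k moves of
    -- a star potential, and one move more.
    cover-or-long : ∀ {κ n} (F : Flooding κ n) → AllFaithful F → Hub κ → (ph : Fin k → Phase) →
                    (∀ i → PhaseInv κ i (ph i)) → (∃ λ i → Active (ph i)) →
                    Cover ⊎ suc (∣ untouchedSet ph ∣ + k) ≤ n
    cover-or-long (done const) _ _ ph inv (i , act) =
      ⊥-elim (St.intact⇒¬constant i (proj₂ (active⇒waiting act (inv i))) const)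
    cover-or-long (move {col = κ} u c κ' mv F) faithful H ph inv (i₀ , act₀)
      with any? (λ j → ¬? (decided? (ph j)) ×-dec IChanges? κ κ' j)
    -- No active class is touched: the active class i₀ keeps an intact star.
    ... | no none = inj₂ (s≤s (untouched-bound F (proj₂ ∘ faithful) (untouchedSet ph) untouched' intact₀))
      where
      inv' : ∀ {i} → Active (ph i) → PhaseInv κ' i (ph i)
      inv' {i} act = phase-kept (ph i) mv (proj₁ (faithful i)) (λ I → none (i , act , I)) (inv i)
      untouched' : ∀ {i} → i ∈ untouchedSet ph → Untouched κ' i
      untouched' {i} i∈ = subst (PhaseInv κ' i) eq (inv' (untouched-active eq))
        where eq = ∈-select⁻ (untouched? ∘ ph) i∈
      intact₀ : Intact κ' i₀
      intact₀ = proj₂ (active⇒waiting act₀ (inv' act₀))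
    ... | yes (j , act-j , s , chI) with active-move mv (proj₁ ∘ faithful) H inv act-j chI
    ...   | after-move H' intact-j p inv-j others with any? (λ i → ¬? (decided? ((ph [ j ↦ p ]) i)))
    ...     | yes act' = map₂ (one-more (∣untouched∣-update ph j p))
        (cover-or-long F (proj₂ ∘ faithful) H' (ph [ j ↦ p ]) (update-inv inv-j others) act')
    ...     | no none' = map₂ (one-more (≤-trans (∣untouched∣-update ph j p)
                                                          (≤-reflexive (cong suc (none-active⇒no-untouched none')))))
        (decided-finish F (proj₂ (faithful j)) H' (all-decided (update-inv inv-j others) none') intact-j)

lemma5 : (k r : ℕ) → 1 ≤ k → (m : Fin k → ℕ) → (S : (i : Fin k) → Fin (m i) → Subset r) →
    Construction.OPTFree≤ k r m S (Construction.col k r m S) (2 * k) →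
    Σ ((i : Fin k) → Fin (m i)) (λ σ → (e : Fin r) → ∃ (λ i → e ∈ S i (σ i)))
lemma5 k r 1≤k m S (n , n≤2k , F) =
  [ id , ⊥-elim ∘ too-long ]′
    (cover-or-long F faithful initial-hub (const untouched) (λ _ → initially-untouched) (fromℕ< 1≤k , λ ()))
  where
  open Reduction k r m S

  -- 3k stars per class and at most 2k moves: each class has a faithful star.
  n<∣⊤∣ : n < ∣ ⊤ {3 * k} ∣
  n<∣⊤∣ = subst (n <_) (sym (∣⊤∣≡n (3 * k))) (≤-trans (s≤s n≤2k) (m<n+m (2 * k) 1≤k))

  star : Fin k → Fin (3 * k)
  star i = proj₁ (faithful-star F i ⊤ n<∣⊤∣)

  open Bounds star

  faithful : AllFaithful F
  faithful i = proj₂ (proj₂ (faithful-star F i ⊤ n<∣⊤∣))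

  initial-hub : Hub (Construction.col k r m S)
  initial-hub = record { L-hub = λ _ _ → refl ; E-hub = λ _ → refl ; U-hub = refl }

  initially-untouched : ∀ {i} → Untouched (Construction.col k r m S) i
  initially-untouched = (λ _ → refl) , record { centre-K = refl ; pendants-original = λ _ → refl }

  -- All k classes start untouched, so a long run needs 2k + 1 moves.
  too-long : suc (∣ untouchedSet (const untouched) ∣ + k) ≤ n → ⊥
  too-long long = n≮n (k + k) (≤-trans (≤-trans (s≤s (+-monoˡ-≤ k all-untouched)) long)
                                       (≤-trans n≤2k (≤-reflexive (cong (k +_) (+-identityʳ k)))))
    where
    all-untouched : k ≤ ∣ untouchedSet (const untouched) ∣
    all-untouched = n≤∣select∣ (untouched? ∘ const untouched) (λ _ → refl)
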